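{- For every bipartite graph $G$ with bipartition $X\cup Y$, $\mathrm{mis}(G)\le \mathrm{irr}(G)$.
   Context: $\mathrm{mis}(G)$ is the number of maximal independent sets of $G$. A set $X'\subseteq X$ is irredundant if for every $x\in X'$, $N(x)\not\subseteq N(X'\setminus\{x\})$, where $N(x)$ is the neighborhood of $x$ and $N(S)=\bigcup_{x\in S}N(x)$. $\mathrm{irr}(G)$ is the number of irredundant subsets of $X$ (including the empty set). -}

module Defs where

open import Data.Nat using (ℕ; zero; suc)
open import Data.Bool using (Bool; true; false; T; T?)
open import Data.Fin using (Fin)
open import Data.Fin.Subset using (Subset; _∈_; _∉_; _∪_; ⁅_⁆; _-_; inside; outside)
open import Data.Fin.Subset.Properties using (_∈?_)
open import Data.Fin.Properties using (all?; any?)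
open import Data.Vec using (tabulate; _∷_; [])
open import Data.List using (List; []; _∷_; map; _++_; filter; length; cartesianProduct)
open import Data.Sum using (_⊎_; inj₁; inj₂)
open import Data.Product using (_×_; _,_; ∃)
open import Data.Empty using (⊥)
open import Relation.Nullary using (¬_; Dec; yes; no)
open import Relation.Nullary.Decidable using (_×-dec_; ¬?)
open import Relation.Unary using (Decidable)

-- A finite bipartite graph G with bipartition X ∪ Y, where X = Fin m and
-- Y = Fin n; edges only join X to Y and are given by an adjacency matrix.
record BipGraph (m n : ℕ) : Set where
  field
    adj : Fin m → Fin n → Bool

module _ {m n : ℕ} (G : BipGraph m n) where
  open BipGraph G

  Vertex : Set
  Vertex = Fin m ⊎ Fin n

  Adjacent : Vertex → Vertex → Set
  Adjacent (inj₁ x) (inj₂ y) = T (adj x y)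
  Adjacent (inj₂ y) (inj₁ x) = T (adj x y)
  Adjacent (inj₁ _) (inj₁ _) = ⊥
  Adjacent (inj₂ _) (inj₂ _) = ⊥

  VSet : Set
  VSet = Subset m × Subset n

  _∈V_ : Vertex → VSet → Set
  inj₁ x ∈V (A , B) = x ∈ A
  inj₂ y ∈V (A , B) = y ∈ B

  insertV : Vertex → VSet → VSet
  insertV (inj₁ x) (A , B) = (⁅ x ⁆ ∪ A , B)
  insertV (inj₂ y) (A , B) = (A , ⁅ y ⁆ ∪ B)

  Independent : VSet → Set
  Independent S = ∀ u v → u ∈V S → v ∈V S → ¬ Adjacent u v

  MaximalIndependent : VSet → Set
  MaximalIndependent S = Independent S × (∀ v → ¬ (v ∈V S) → ¬ Independent (insertV v S))

  N : Fin m → Subset n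
  N x = tabulate (adj x)

  _∈N_ : Fin n → Subset m → Set
  y ∈N S = ∃ λ x → x ∈ S × y ∈ N x

  Irredundant : Subset m → Set
  Irredundant X' = ∀ x → x ∈ X' → ¬ (∀ y → y ∈ N x → y ∈N (X' - x))

  private
    ∈V? : ∀ v S → Dec (v ∈V S)
    ∈V? (inj₁ x) (A , B) = x ∈? A
    ∈V? (inj₂ y) (A , B) = y ∈? B

    adj? : ∀ u v → Dec (Adjacent u v)
    adj? (inj₁ x) (inj₂ y) = T? (adj x y)
    adj? (inj₂ y) (inj₁ x) = T? (adj x y)
    adj? (inj₁ _) (inj₁ _) = no λ ()
    adj? (inj₂ _) (inj₂ _) = no λ ()

    allV? : {P : Vertex → Set} → (∀ v → Dec (P v)) → Dec (∀ v → P v)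
    allV? {P} P? with all? (λ x → P? (inj₁ x)) | all? (λ y → P? (inj₂ y))
    ... | yes p | yes q = yes λ { (inj₁ x) → p x ; (inj₂ y) → q y }
    ... | no ¬p | _ = no λ h → ¬p (λ x → h (inj₁ x))
    ... | yes _ | no ¬q = no λ h → ¬q (λ y → h (inj₂ y))

    imp? : {P Q : Set} → Dec P → Dec Q → Dec (P → Q)
    imp? (yes p) (yes q) = yes λ _ → q
    imp? (yes p) (no ¬q) = no λ f → ¬q (f p)
    imp? (no ¬p) _ = yes λ p → Data.Empty.⊥-elim (¬p p)
      where import Data.Empty

  independent? : ∀ S → Dec (Independent S)
  independent? S = allV? λ u → allV? λ v →
    imp? (∈V? u S) (imp? (∈V? v S) (¬? (adj? u v)))

  maximalIndependent? : ∀ S → Dec (MaximalIndependent S)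
  maximalIndependent? S = independent? S ×-dec
    allV? (λ v → imp? (¬? (∈V? v S)) (¬? (independent? (insertV v S))))

  irredundant? : ∀ X' → Dec (Irredundant X')
  irredundant? X' = all? λ x → imp? (x ∈? X')
    (¬? (all? λ y → imp? (y ∈? N x)
          (any? λ x' → (x' ∈? (X' - x)) ×-dec (y ∈? N x'))))

allSubsets : (k : ℕ) → List (Subset k)
allSubsets zero = [] ∷ []
allSubsets (suc k) = map (outside ∷_) (allSubsets k) ++ map (inside ∷_) (allSubsets k)

module _ {m n : ℕ} (G : BipGraph m n) where
  mis : ℕ
  mis = length (filter (maximalIndependent? G) (cartesianProduct (allSubsets m) (allSubsets n)))

  -- irr(G): number of irredundant subsets of X (including ∅)
  irr : ℕ
  irr = length (filter (irredundant? G) (allSubsets m))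

module Submission where

-- Idea: send a maximal independent set (A , B), A ⊆ X, B ⊆ Y, to an
-- irredundant subset of X with the same neighbourhood N(A).
--   * Every A ⊆ X has such an "irredundant core": while A has an element x
--     with N(x) ⊆ N(A ∖ {x}), delete it; N(A) does not change, and the
--     process stops since A shrinks (well-founded induction on ⊂).
--   * A maximal independent set is determined by N(A): maximality forces
--     B = Y ∖ N(A) and A = { x | N(x) ∩ B = ∅ }.
-- Hence two maximal independent sets with the same core are equal, so the
-- core map is injective from maximal independent sets into irredundant
-- sets, and a pigeonhole count on the enumerating lists finishes the proof.

open import Defs
open import Data.Nat using (ℕ; zero; suc; _≤_)
open import Data.Bool using (T)
open import Data.Bool.Properties using (T-≡)
open import Data.Fin using (Fin; zero; suc)
open import Data.Fin.Properties using (injective⇒≤; all?; any?; _≟_)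
open import Data.Fin.Subset using (Subset; inside; outside; ⁅_⁆; _-_; _∈_; _⊆_; _⊂_)
open import Data.Fin.Subset.Properties
  using (_∈?_; x∈p∪q⁻; x∈⁅y⁆⇒x≡y; x∈p∧x≢y⇒x∈p-y; p─q⊆p; x∈p⇒p-x⊂p; ⊆-antisym)
open import Data.Fin.Subset.Induction using (⊂-wellFounded; Acc; acc)
open import Data.Vec using (_∷_; []) renaming (lookup to lookupᵥ)
open import Data.Vec.Properties using ([]=⇒lookup; lookup⇒[]=; lookup∘tabulate)
open import Data.List using (List; length; lookup; map; filter; cartesianProduct)
open import Data.List.Membership.Propositional renaming (_∈_ to _∈ₗ_)
open import Data.List.Membership.Propositional.Properties
  using (∈-lookup; ∈-map⁺; ∈-map⁻; ∈-++⁺ˡ; ∈-++⁺ʳ; ∈-filter⁺; ∈-filter⁻)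
open import Data.List.Relation.Unary.Any using (here; index)
open import Data.List.Relation.Unary.Any.Properties using (lookup-index)
import Data.List.Relation.Unary.All as All
open import Data.List.Relation.Unary.AllPairs using ([]; _∷_)
open import Data.List.Relation.Unary.Unique.Propositional using (Unique)
open import Data.List.Relation.Unary.Unique.Propositional.Properties
  using (++⁺; map⁺; cartesianProduct⁺; filter⁺)
open import Data.Sum using (_⊎_; inj₁; inj₂)
open import Data.Product using (Σ; ∃; _×_; _,_; proj₁; proj₂)
open import Function using (_∘_; id; Equivalence)
open import Relation.Nullary using (¬_; Dec; yes; no; contradiction)
open import Relation.Nullary.Decidable using (_×-dec_; _→-dec_; decidable-stable)
open import Relation.Binary.PropositionalEquality using (_≡_; refl; sym; trans; cong; cong₂)
open Relation.Binary.PropositionalEquality.≡-Reasoning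

module _ {A B : Set} where

  unique-lookup-injective : ∀ {xs : List A} → Unique xs →
                            ∀ i j → lookup xs i ≡ lookup xs j → i ≡ j
  unique-lookup-injective (_ ∷ _) zero zero _ = refl
  unique-lookup-injective (x∉xs ∷ _) zero (suc j) eq =
    contradiction eq (All.lookup x∉xs (∈-lookup j))
  unique-lookup-injective (x∉xs ∷ _) (suc i) zero eq =
    contradiction (sym eq) (All.lookup x∉xs (∈-lookup i))
  unique-lookup-injective (_ ∷ uniq) (suc i) (suc j) eq =
    cong suc (unique-lookup-injective uniq i j eq)

  -- If g is injective on the duplicate-free list xs and maps it into ys,
  -- then xs is no longer than ys: positions in xs inject into positions in
  -- ys, and the pigeonhole principle for Fin applies.
  length-≤-by-injection : (g : A → B) (xs : List A) (ys : List B) → Unique xs →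
    (∀ {a b} → a ∈ₗ xs → b ∈ₗ xs → g a ≡ g b → a ≡ b) →
    (∀ {a} → a ∈ₗ xs → g a ∈ₗ ys) → length xs ≤ length ys
  length-≤-by-injection g xs ys uniq g-injective g-into = injective⇒≤ position-injective
    where
    position : Fin (length xs) → Fin (length ys)
    position i = index (g-into (∈-lookup i))

    image-at-position : ∀ i → g (lookup xs i) ≡ lookup ys (position i)
    image-at-position i = lookup-index (g-into (∈-lookup i))

    position-injective : ∀ {i j} → position i ≡ position j → i ≡ j
    position-injective {i} {j} eq = unique-lookup-injective uniq i j
      (g-injective (∈-lookup i) (∈-lookup j) (begin
        g (lookup xs i)        ≡⟨ image-at-position i ⟩
        lookup ys (position i) ≡⟨ cong (lookup ys) eq ⟩
        lookup ys (position j) ≡⟨ sym (image-at-position j) ⟩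
        g (lookup xs j)        ∎))

allSubsets-complete : ∀ {k} (s : Subset k) → s ∈ₗ allSubsets k
allSubsets-complete [] = here refl
allSubsets-complete (outside ∷ s) = ∈-++⁺ˡ (∈-map⁺ (outside ∷_) (allSubsets-complete s))
allSubsets-complete (inside ∷ s) = ∈-++⁺ʳ _ (∈-map⁺ (inside ∷_) (allSubsets-complete s))

allSubsets-unique : ∀ k → Unique (allSubsets k)
allSubsets-unique zero = All.[] ∷ []
allSubsets-unique (suc k) =
  ++⁺ (map⁺ ∷-injectiveʳ (allSubsets-unique k)) (map⁺ ∷-injectiveʳ (allSubsets-unique k))
      head-differs
  where
  ∷-injectiveʳ : ∀ {b} {s t : Subset k} → b ∷ s ≡ b ∷ t → s ≡ t
  ∷-injectiveʳ refl = refl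

  head-differs : ∀ {v} → ¬ (v ∈ₗ map (outside ∷_) (allSubsets k) ×
                            v ∈ₗ map (inside ∷_) (allSubsets k))
  head-differs (p , q) with ∈-map⁻ (outside ∷_) p | ∈-map⁻ (inside ∷_) q
  ... | _ , _ , refl | _ , _ , ()

module _ {m n : ℕ} (G : BipGraph m n) where
  open BipGraph G

  ∈N⇒adj : ∀ {x y} → y ∈ N G x → T (adj x y)
  ∈N⇒adj {x} {y} y∈Nx = Equivalence.from T-≡ (begin
    adj x y            ≡⟨ sym (lookup∘tabulate (adj x) y) ⟩
    lookupᵥ (N G x) y  ≡⟨ []=⇒lookup y∈Nx ⟩
    inside             ∎)

  adj⇒∈N : ∀ {x y} → T (adj x y) → y ∈ N G x
  adj⇒∈N {x} {y} xy = lookup⇒[]= y (N G x)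
    (trans (lookup∘tabulate (adj x) y) (Equivalence.to T-≡ xy))

  adjacent-sym : ∀ u v → Adjacent G u v → Adjacent G v u
  adjacent-sym (inj₁ _) (inj₂ _) uv = uv
  adjacent-sym (inj₂ _) (inj₁ _) uv = uv

  adjacent-irrefl : ∀ v → ¬ Adjacent G v v
  adjacent-irrefl (inj₁ _) ()
  adjacent-irrefl (inj₂ _) ()

  ∈-insertV⁻ : ∀ u v (S : VSet G) → _∈V_ G u (insertV G v S) → u ≡ v ⊎ _∈V_ G u S
  ∈-insertV⁻ (inj₁ x) (inj₁ x') (A , B) x∈ with x∈p∪q⁻ ⁅ x' ⁆ A x∈
  ... | inj₁ x∈⁅x'⁆ = inj₁ (cong inj₁ (x∈⁅y⁆⇒x≡y x' x∈⁅x'⁆))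
  ... | inj₂ x∈A = inj₂ x∈A
  ∈-insertV⁻ (inj₁ _) (inj₂ _) _ x∈A = inj₂ x∈A
  ∈-insertV⁻ (inj₂ _) (inj₁ _) _ y∈B = inj₂ y∈B
  ∈-insertV⁻ (inj₂ y) (inj₂ y') (A , B) y∈ with x∈p∪q⁻ ⁅ y' ⁆ B y∈
  ... | inj₁ y∈⁅y'⁆ = inj₁ (cong inj₂ (x∈⁅y⁆⇒x≡y y' y∈⁅y'⁆))
  ... | inj₂ y∈B = inj₂ y∈B

  insert-independent : ∀ v S → Independent G S →
    (∀ u → _∈V_ G u S → ¬ Adjacent G v u) → Independent G (insertV G v S)
  insert-independent v S S-indep v-free u w u∈ w∈
    with ∈-insertV⁻ u v S u∈ | ∈-insertV⁻ w v S w∈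
  ... | inj₁ refl | inj₁ refl = adjacent-irrefl v
  ... | inj₁ refl | inj₂ w∈S = v-free w w∈S
  ... | inj₂ u∈S | inj₁ refl = v-free u u∈S ∘ adjacent-sym u v
  ... | inj₂ u∈S | inj₂ w∈S = S-indep u w u∈S w∈S

  -- Hence every vertex outside a maximal independent set has a neighbour in
  -- it (in the double-negated form that maximality gives constructively).
  maximal-dominates : ∀ S → MaximalIndependent G S → ∀ v → ¬ _∈V_ G v S →
    ¬ (∀ u → _∈V_ G u S → ¬ Adjacent G v u)
  maximal-dominates S (S-indep , S-maximal) v v∉S v-free =
    S-maximal v v∉S (insert-independent v S S-indep v-free)

  _∈N?_ : ∀ y A → Dec (_∈N_ G y A)
  y ∈N? A = any? λ x → (x ∈? A) ×-dec (y ∈? N G x)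

  _⊆N_ : Subset m → Subset m → Set
  A ⊆N A' = ∀ {y} → _∈N_ G y A → _∈N_ G y A'

  ⊆⇒⊆N : ∀ {A A'} → A ⊆ A' → A ⊆N A'
  ⊆⇒⊆N A⊆A' (x , x∈A , y∈Nx) = x , A⊆A' x∈A , y∈Nx

  Redundant : Subset m → Fin m → Set
  Redundant A x = ∀ y → y ∈ N G x → _∈N_ G y (A - x)

  redundant? : ∀ A x → Dec (Redundant A x)
  redundant? A x = all? λ y → (y ∈? N G x) →-dec (y ∈N? (A - x))

  redundant-element : ∀ A → ¬ Irredundant G A → ∃ λ x → x ∈ A × Redundant A x
  redundant-element A A-redundant with any? (λ x → (x ∈? A) ×-dec redundant? A x)
  ... | yes witness = witness
  ... | no none = contradiction (λ x x∈A x-red → none (x , x∈A , x-red)) A-redundant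

  remove-redundant : ∀ {A x} → Redundant A x → A ⊆N (A - x)
  remove-redundant {A} {x} x-red {y} (x' , x'∈A , y∈Nx') with x' ≟ x
  ... | yes refl = x-red y y∈Nx'
  ... | no x'≢x = x' , x∈p∧x≢y⇒x∈p-y x'∈A x'≢x , y∈Nx'

  IrredundantCore : Subset m → Set
  IrredundantCore A = Σ (Subset m) λ A' → Irredundant G A' × A ⊆N A' × A' ⊆N A

  irredundant-core : ∀ A → IrredundantCore A
  irredundant-core A = reduce A (⊂-wellFounded A)
    where
    reduce : ∀ A → Acc _⊂_ A → IrredundantCore A
    reduce A (acc smaller) with irredundant? G A
    ... | yes A-irr = A , A-irr , id , id
    ... | no A-red with redundant-element A A-red
    ... | x , x∈A , x-red with reduce (A - x) (smaller (x∈p⇒p-x⊂p x∈A))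
    ... | A' , A'-irr , A-x⊆A' , A'⊆A-x =
      A' , A'-irr , A-x⊆A' ∘ remove-redundant x-red , ⊆⇒⊆N (p─q⊆p A ⁅ x ⁆) ∘ A'⊆A-x

  core : Subset m → Subset m
  core A = proj₁ (irredundant-core A)

  module _ {A B} (mis-AB : MaximalIndependent G (A , B)) where

    mis-Y-avoids-N : ∀ {y} → y ∈ B → ¬ _∈N_ G y A
    mis-Y-avoids-N {y} y∈B (x , x∈A , y∈Nx) = proj₁ mis-AB (inj₁ x) (inj₂ y) x∈A y∈B (∈N⇒adj y∈Nx)

    mis-Y-complete : ∀ {y} → ¬ _∈N_ G y A → y ∈ B
    mis-Y-complete {y} y∉NA = decidable-stable (y ∈? B) λ y∉B →
      maximal-dominates (A , B) mis-AB (inj₂ y) y∉B λ where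
        (inj₁ x) x∈A xy → y∉NA (x , x∈A , adj⇒∈N xy)

    mis-X-free : ∀ {x y} → x ∈ A → y ∈ B → ¬ T (adj x y)
    mis-X-free {x} {y} = proj₁ mis-AB (inj₁ x) (inj₂ y)

    mis-X-complete : ∀ {x} → (∀ {y} → y ∈ B → ¬ T (adj x y)) → x ∈ A
    mis-X-complete {x} x-free = decidable-stable (x ∈? A) λ x∉A →
      maximal-dominates (A , B) mis-AB (inj₁ x) x∉A λ where
        (inj₂ y) y∈B → x-free y∈B

  mis-Y-antitone : ∀ {A B A' B'} → MaximalIndependent G (A , B) → MaximalIndependent G (A' , B') →
                   A' ⊆N A → B ⊆ B'
  mis-Y-antitone mis-AB mis-A'B' A'⊆NA y∈B =
    mis-Y-complete mis-A'B' (mis-Y-avoids-N mis-AB y∈B ∘ A'⊆NA)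

  mis-X-antitone : ∀ {A B A' B'} → MaximalIndependent G (A , B) → MaximalIndependent G (A' , B') →
                   B' ⊆ B → A ⊆ A'
  mis-X-antitone mis-AB mis-A'B' B'⊆B x∈A =
    mis-X-complete mis-A'B' (mis-X-free mis-AB x∈A ∘ B'⊆B)

  mis-determined-by-N : ∀ {A B A' B'} → MaximalIndependent G (A , B) → MaximalIndependent G (A' , B') →
                        A ⊆N A' → A' ⊆N A → (A , B) ≡ (A' , B')
  mis-determined-by-N mis-AB mis-A'B' A⊆NA' A'⊆NA = cong₂ _,_
    (⊆-antisym (mis-X-antitone mis-AB mis-A'B' B'⊆B) (mis-X-antitone mis-A'B' mis-AB B⊆B'))
    (⊆-antisym B⊆B' B'⊆B)
    where
    B⊆B' = mis-Y-antitone mis-AB mis-A'B' A'⊆NA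
    B'⊆B = mis-Y-antitone mis-A'B' mis-AB A⊆NA'

  -- Consequently, the X-part's irredundant core is injective on maximal
  -- independent sets: equal cores mean equal neighbourhoods.
  core-injective : ∀ {A B A' B'} → MaximalIndependent G (A , B) → MaximalIndependent G (A' , B') →
                   core A ≡ core A' → (A , B) ≡ (A' , B')
  core-injective {A} {B} {A'} {B'} mis-AB mis-A'B' same-core
    with irredundant-core A | irredundant-core A' | same-core
  ... | C , _ , A⊆NC , C⊆NA | .C , _ , A'⊆NC , C⊆NA' | refl =
    mis-determined-by-N mis-AB mis-A'B' (C⊆NA' ∘ A⊆NC) (C⊆NA ∘ A'⊆NC)

proposition4p1 : ∀ {m n : ℕ} (G : BipGraph m n) → mis G ≤ irr G
proposition4p1 {m} {n} G =
  length-≤-by-injection (core G ∘ proj₁) maximal-sets irredundant-sets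
    (filter⁺ (maximalIndependent? G) (cartesianProduct⁺ (allSubsets-unique m) (allSubsets-unique n)))
    (λ S∈ S'∈ → core-injective G (is-maximal S∈) (is-maximal S'∈))
    (λ {(A , _)} _ → ∈-filter⁺ (irredundant? G) (allSubsets-complete (core G A))
                                (proj₁ (proj₂ (irredundant-core G A))))
  where
  all-vertex-sets : List (VSet G)
  all-vertex-sets = cartesianProduct (allSubsets m) (allSubsets n)

  maximal-sets : List (VSet G)
  maximal-sets = filter (maximalIndependent? G) all-vertex-sets

  irredundant-sets : List (Subset m)
  irredundant-sets = filter (irredundant? G) (allSubsets m)

  is-maximal : ∀ {S} → S ∈ₗ maximal-sets → MaximalIndependent G S
  is-maximal = proj₂ ∘ ∈-filter⁻ (maximalIndependent? G) {xs = all-vertex-sets}
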